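{- For every integer $r\ge 0$ there exist polynomials $P_r$ and $Q_r$, each of degree exactly $r$ and with integer coefficients, such that for every positive integer $n$, \[ S_{2r+1}(n)=P_r(n)\,n\binom{2n}{n} \qquad\text{and}\qquad S_{2r}(n)=Q_r(n)\,2^{2n-r}, \] where $S_m(n)=\sum_{k=0}^{2n}\binom{2n}{k}\,|n-k|^{m}$.
   Context: For integers $m\ge 0$ and $n\ge 0$, $S_m(n)=\sum_{k=0}^{2n}\binom{2n}{k}|n-k|^m$, with the convention $0^0=1$. -}

module Defs where

open import Data.Nat using (ℕ; zero; suc; _+_; _*_; _^_; ∣_-_∣)
open import Data.Nat.Combinatorics using (_C_)
open import Data.Integer using (ℤ; +_) renaming (_+_ to _+ℤ_; _*_ to _*ℤ_)
open import Data.Vec using (Vec; []; _∷_)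

sumTo : ℕ → (ℕ → ℕ) → ℕ
sumTo zero    f = f 0
sumTo (suc m) f = sumTo m f + f (suc m)

-- S_m(n) = Σ_{k=0}^{2n} C(2n,k) |n-k|^m   (ℕ's _^_ has 0^0 = 1)
S : ℕ → ℕ → ℕ
S m n = sumTo (2 * n) (λ k → ((2 * n) C k) * (∣ n - k ∣ ^ m))

-- A polynomial with integer coefficients of degree ≤ d is a vector of its
-- d+1 coefficients, constant term first.  Evaluation by Horner's rule.
eval : ∀ {d} → Vec ℤ d → ℤ → ℤ
eval []       x = + 0
eval (c ∷ cs) x = c +ℤ x *ℤ eval cs x

module Submission where

-- Since |a − k|² + k(2a − k) = a² and k(N − k)·C(N, k) = N(N − 1)·C(N − 2, k − 1), the moments
-- satisfy S_{m+2}(n+1) = (n+1)² S_m(n+1) − (2n+2)(2n+1) S_m(n).  Starting from S_0(n) = 4ⁿ and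
-- S_1(n) = n·C(2n, n), and using (n+1)·C(2n+2, n+1) = 2(2n+1)·C(2n, n), induction on r gives the
-- claimed forms with P_0 = Q_0 = 1 and
--   P_{r+1}(x) = x (x P_r(x) − (x−1) P_r(x−1)),   Q_{r+1}(x) = x (2x Q_r(x) − (2x−1) Q_r(x−1)),
-- whose leading coefficients are r+1 resp. 2r+1 times those of P_r resp. Q_r, hence nonzero.

open import Defs using (sumTo; S; eval)

module BinomialSums where

  open import Data.Nat
  open import Data.Nat.Properties
  open import Data.Nat.Combinatorics using (_C_; nCk+nC[k+1]≡[n+1]C[k+1]; nC1≡n; k>n⇒nCk≡0)
  open import Data.Nat.Tactic.RingSolver using (solve-∀)
  open import Data.Sum using (inj₁; inj₂)
  open import Data.Product using (_,_)
  open import Function using (_∘_)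
  open import Relation.Binary.PropositionalEquality
  open ≡-Reasoning
  import Algebra.Properties.CommutativeSemigroup as CommSemigroupProperties
  module +-CS = CommSemigroupProperties +-commutativeSemigroup
  module *-CS = CommSemigroupProperties *-commutativeSemigroup

  2*n≡n+n : ∀ n → 2 * n ≡ n + n
  2*n≡n+n = solve-∀

  2*[1+n]≡2+2*n : ∀ n → 2 * suc n ≡ 2 + 2 * n
  2*[1+n]≡2+2*n = solve-∀

  sumTo-cong : ∀ m {f g : ℕ → ℕ} → (∀ k → k ≤ m → f k ≡ g k) → sumTo m f ≡ sumTo m g
  sumTo-cong zero    f≗g = f≗g 0 z≤n
  sumTo-cong (suc m) f≗g =
    cong₂ _+_ (sumTo-cong m (λ k k≤m → f≗g k (m≤n⇒m≤1+n k≤m))) (f≗g (suc m) ≤-refl)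

  sumTo-+ : ∀ m (f g : ℕ → ℕ) → sumTo m (λ k → f k + g k) ≡ sumTo m f + sumTo m g
  sumTo-+ zero    f g = refl
  sumTo-+ (suc m) f g = begin
    sumTo m (λ k → f k + g k) + (f (suc m) + g (suc m))
      ≡⟨ cong (_+ (f (suc m) + g (suc m))) (sumTo-+ m f g) ⟩
    (sumTo m f + sumTo m g) + (f (suc m) + g (suc m))
      ≡⟨ +-CS.interchange (sumTo m f) (sumTo m g) (f (suc m)) (g (suc m)) ⟩
    (sumTo m f + f (suc m)) + (sumTo m g + g (suc m)) ∎

  sumTo-*ˡ : ∀ m c (f : ℕ → ℕ) → sumTo m (λ k → c * f k) ≡ c * sumTo m f
  sumTo-*ˡ zero    c f = refl
  sumTo-*ˡ (suc m) c f = begin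
    sumTo m (λ k → c * f k) + c * f (suc m) ≡⟨ cong (_+ c * f (suc m)) (sumTo-*ˡ m c f) ⟩
    c * sumTo m f + c * f (suc m)           ≡⟨ *-distribˡ-+ c (sumTo m f) (f (suc m)) ⟨
    c * (sumTo m f + f (suc m))             ∎

  sumTo-suc : ∀ m (f : ℕ → ℕ) → sumTo (suc m) f ≡ f 0 + sumTo m (λ k → f (suc k))
  sumTo-suc zero    f = refl
  sumTo-suc (suc m) f =
    trans (cong (_+ f (2 + m)) (sumTo-suc m f)) (+-assoc (f 0) _ _)

  binomialSum : ℕ → (ℕ → ℕ) → ℕ
  binomialSum N g = sumTo N (λ k → (N C k) * g k)

  binomialSum-cong : ∀ N {f g : ℕ → ℕ} → (∀ k → k ≤ N → f k ≡ g k) →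
                     binomialSum N f ≡ binomialSum N g
  binomialSum-cong N f≗g = sumTo-cong N (λ k k≤N → cong ((N C k) *_) (f≗g k k≤N))

  binomialSum-+ : ∀ N (f g : ℕ → ℕ) →
                  binomialSum N (λ k → f k + g k) ≡ binomialSum N f + binomialSum N g
  binomialSum-+ N f g = trans (sumTo-cong N (λ k _ → *-distribˡ-+ (N C k) (f k) (g k)))
                              (sumTo-+ N _ _)

  binomialSum-*ˡ : ∀ N c (f : ℕ → ℕ) → binomialSum N (λ k → c * f k) ≡ c * binomialSum N f
  binomialSum-*ˡ N c f = trans (sumTo-cong N (λ k _ → *-CS.x∙yz≈y∙xz (N C k) c (f k)))
                               (sumTo-*ˡ N c _)

  binomialSum-suc : ∀ N (g : ℕ → ℕ) →
                    binomialSum (suc N) g ≡ binomialSum N (λ k → g k + g (suc k))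
  binomialSum-suc N g = begin
    binomialSum (suc N) g
      ≡⟨ sumTo-suc N _ ⟩
    1 * g 0 + sumTo N (λ k → (suc N C suc k) * g (suc k))
      ≡⟨ cong (1 * g 0 +_) (sumTo-cong N (λ k _ → pascal k)) ⟩
    1 * g 0 + sumTo N (λ k → (N C k) * g (suc k) + (N C suc k) * g (suc k))
      ≡⟨ cong (1 * g 0 +_) (sumTo-+ N _ _) ⟩
    1 * g 0 + (binomialSum N (g ∘ suc) + lower)
      ≡⟨ +-CS.x∙yz≈xz∙y (1 * g 0) (binomialSum N (g ∘ suc)) lower ⟩
    (1 * g 0 + lower) + binomialSum N (g ∘ suc)
      ≡⟨ cong (_+ binomialSum N (g ∘ suc)) lower-completes ⟩
    binomialSum N g + binomialSum N (g ∘ suc)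
      ≡⟨ binomialSum-+ N g (g ∘ suc) ⟨
    binomialSum N (λ k → g k + g (suc k)) ∎
    where
    pascal : ∀ k → (suc N C suc k) * g (suc k) ≡ (N C k) * g (suc k) + (N C suc k) * g (suc k)
    pascal k = trans (cong (_* g (suc k)) (sym (nCk+nC[k+1]≡[n+1]C[k+1] N k)))
                     (*-distribʳ-+ (g (suc k)) (N C k) (N C suc k))
    lower : ℕ
    lower = sumTo N (λ k → (N C suc k) * g (suc k))
    lower-completes : 1 * g 0 + lower ≡ binomialSum N g
    lower-completes = begin
      1 * g 0 + lower                                      ≡⟨ sumTo-suc N _ ⟨
      binomialSum N g + (N C suc N) * g (suc N)            ≡⟨ cong (λ c → binomialSum N g + c * g (suc N)) (k>n⇒nCk≡0 (n<1+n N)) ⟩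
      binomialSum N g + 0                                  ≡⟨ +-identityʳ _ ⟩
      binomialSum N g                                      ∎

  binomialSum-const : ∀ N → binomialSum N (λ _ → 1) ≡ 2 ^ N
  binomialSum-const zero    = refl
  binomialSum-const (suc N) = begin
    binomialSum (suc N) (λ _ → 1)   ≡⟨ binomialSum-suc N _ ⟩
    binomialSum N (λ _ → 2 * 1)     ≡⟨ binomialSum-*ˡ N 2 _ ⟩
    2 * binomialSum N (λ _ → 1)     ≡⟨ cong (2 *_) (binomialSum-const N) ⟩
    2 * 2 ^ N                       ∎

  δ : ℕ → ℕ → ℕ
  δ zero    zero    = 1
  δ zero    (suc _) = 0
  δ (suc _) zero    = 0
  δ (suc n) (suc i) = δ n i

  δ-refl : ∀ n → δ n n ≡ 1
  δ-refl zero    = refl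
  δ-refl (suc n) = δ-refl n

  <⇒δ≡0 : ∀ {n i} → n < i → δ n i ≡ 0
  <⇒δ≡0 {zero}  {suc i} _         = refl
  <⇒δ≡0 {suc n} {suc i} (s≤s n<i) = <⇒δ≡0 n<i

  >⇒δ≡0 : ∀ {n i} → i < n → δ n i ≡ 0
  >⇒δ≡0 {suc n} {zero}  _         = refl
  >⇒δ≡0 {suc n} {suc i} (s≤s i<n) = >⇒δ≡0 i<n

  sumTo-*δ≡0 : ∀ M {n} (c : ℕ → ℕ) → M < n → sumTo M (λ i → c i * δ n i) ≡ 0
  sumTo-*δ≡0 zero    c M<n = trans (cong (c 0 *_) (>⇒δ≡0 M<n)) (*-zeroʳ (c 0))
  sumTo-*δ≡0 (suc M) c M<n =
    cong₂ _+_ (sumTo-*δ≡0 M c (<-trans (n<1+n M) M<n))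
              (trans (cong (c (suc M) *_) (>⇒δ≡0 M<n)) (*-zeroʳ (c (suc M))))

  sumTo-*δ : ∀ M {n} (c : ℕ → ℕ) → n ≤ M → sumTo M (λ i → c i * δ n i) ≡ c n
  sumTo-*δ zero    c z≤n = *-identityʳ (c 0)
  sumTo-*δ (suc M) {n} c n≤1+M with m≤n⇒m<n∨m≡n n≤1+M
  ... | inj₁ (s≤s n≤M) = begin
    sumTo M (λ i → c i * δ n i) + c (suc M) * δ n (suc M)
      ≡⟨ cong₂ _+_ (sumTo-*δ M c n≤M) (cong (c (suc M) *_) (<⇒δ≡0 (s≤s n≤M))) ⟩
    c n + c (suc M) * 0
      ≡⟨ cong (c n +_) (*-zeroʳ (c (suc M))) ⟩
    c n + 0
      ≡⟨ +-identityʳ (c n) ⟩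
    c n ∎
  ... | inj₂ refl = begin
    sumTo M (λ i → c i * δ (suc M) i) + c (suc M) * δ (suc M) (suc M)
      ≡⟨ cong₂ _+_ (sumTo-*δ≡0 M c (n<1+n M)) (cong (c (suc M) *_) (δ-refl M)) ⟩
    c (suc M) * 1
      ≡⟨ *-identityʳ (c (suc M)) ⟩
    c (suc M) ∎

  absorption : ∀ n k → suc k * (suc n C suc k) ≡ suc n * (n C k)
  absorption zero    zero    = refl
  absorption zero    (suc k) = trans (cong ((2 + k) *_) (k>n⇒nCk≡0 {1} {2 + k} (s≤s (s≤s z≤n)))) (*-zeroʳ (2 + k))
  absorption (suc n) zero    = trans (+-identityʳ _) (trans (nC1≡n (2 + n)) (sym (*-identityʳ (2 + n))))
  absorption (suc n) (suc k) = begin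
    (2 + k) * ((2 + n) C (2 + k))
      ≡⟨ cong ((2 + k) *_) (nCk+nC[k+1]≡[n+1]C[k+1] (suc n) (suc k)) ⟨
    (2 + k) * (a + b)
      ≡⟨ [2+k]*[a+b]≡a+[[1+k]*a+[2+k]*b] a b k ⟩
    a + ((1 + k) * a + (2 + k) * b)
      ≡⟨ cong (a +_) (cong₂ _+_ (absorption n k) (absorption n (suc k))) ⟩
    a + ((1 + n) * (n C k) + (1 + n) * (n C suc k))
      ≡⟨ cong (a +_) (*-distribˡ-+ (1 + n) (n C k) (n C suc k)) ⟨
    a + (1 + n) * (n C k + n C suc k)
      ≡⟨ cong (λ c → a + (1 + n) * c) (nCk+nC[k+1]≡[n+1]C[k+1] n k) ⟩
    a + (1 + n) * a ∎
    where
    a = suc n C suc k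
    b = suc n C (2 + k)
    [2+k]*[a+b]≡a+[[1+k]*a+[2+k]*b] : ∀ a b k → (2 + k) * (a + b) ≡ a + ((1 + k) * a + (2 + k) * b)
    [2+k]*[a+b]≡a+[[1+k]*a+[2+k]*b] = solve-∀

  -- (n + 1 − k)·C(n + 1, k) = (n + 1)·C(n, k), written with n = k + d to avoid truncated subtraction.
  absorption-complement : ∀ k d → suc d * (suc (k + d) C k) ≡ suc (k + d) * ((k + d) C k)
  absorption-complement zero    d = refl
  absorption-complement (suc k) d = +-cancelˡ-≡ ((1 + k) * c) _ _ (begin
    (1 + k) * c + (1 + d) * c    ≡⟨ *-distribʳ-+ c (1 + k) (1 + d) ⟨
    (1 + k + (1 + d)) * c        ≡⟨ cong (λ m → suc m * c) (+-suc k d) ⟩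
    (2 + n) * c                  ≡⟨ cong ((2 + n) *_) (nCk+nC[k+1]≡[n+1]C[k+1] (suc n) k) ⟨
    (2 + n) * (a + b)            ≡⟨ *-distribˡ-+ (2 + n) a b ⟩
    (2 + n) * a + (2 + n) * b    ≡⟨ cong (_+ (2 + n) * b) (absorption (suc n) k) ⟨
    (1 + k) * c + (2 + n) * b    ∎)
    where
    n = k + d
    a = suc n C k
    b = suc n C suc k
    c = (2 + n) C suc k

  binomial-*-k[N∸k] : ∀ M k → k ≤ M →
                      ((2 + M) C suc k) * (suc k * (suc M ∸ k)) ≡ (2 + M) * (1 + M) * (M C k)
  binomial-*-k[N∸k] M k k≤M with m≤n⇒∃[o]m+o≡n k≤M
  ... | d , refl = begin
    c * (suc k * (suc (k + d) ∸ k))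
      ≡⟨ cong (λ m → c * (suc k * m)) (trans (cong (_∸ k) (sym (+-suc k d))) (m+n∸m≡n k (suc d))) ⟩
    c * (suc k * suc d)
      ≡⟨ *-CS.x∙yz≈yx∙z c (suc k) (suc d) ⟩
    (suc k * c) * suc d
      ≡⟨ cong (_* suc d) (absorption (suc (k + d)) k) ⟩
    (2 + k + d) * (suc (k + d) C k) * suc d
      ≡⟨ *-CS.xy∙z≈x∙zy (2 + k + d) (suc (k + d) C k) (suc d) ⟩
    (2 + k + d) * (suc d * (suc (k + d) C k))
      ≡⟨ cong ((2 + k + d) *_) (absorption-complement k d) ⟩
    (2 + k + d) * (suc (k + d) * ((k + d) C k))
      ≡⟨ *-assoc (2 + k + d) (suc (k + d)) ((k + d) C k) ⟨
    (2 + k + d) * (suc (k + d)) * ((k + d) C k) ∎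
    where
    c = (2 + (k + d)) C suc k

  central-binomial-suc : ∀ n → suc n * ((2 * suc n) C suc n) ≡ 2 * suc (2 * n) * ((2 * n) C n)
  central-binomial-suc n = begin
    suc n * ((2 * suc n) C suc n)
      ≡⟨ cong (λ m → suc n * (m C suc n)) (2*[1+n]≡2+2*n n) ⟩
    suc n * ((2 + 2 * n) C suc n)
      ≡⟨ absorption (suc (2 * n)) n ⟩
    (2 + 2 * n) * (suc (2 * n) C n)
      ≡⟨ [2+2n]*x≡2*[[1+n]*x] n (suc (2 * n) C n) ⟩
    2 * (suc n * (suc (2 * n) C n))
      ≡⟨ cong (λ m → 2 * (suc n * (suc m C n))) (2*n≡n+n n) ⟩
    2 * (suc n * (suc (n + n) C n))
      ≡⟨ cong (2 *_) (absorption-complement n n) ⟩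
    2 * (suc (n + n) * ((n + n) C n))
      ≡⟨ cong (λ m → 2 * (suc m * (m C n))) (2*n≡n+n n) ⟨
    2 * (suc (2 * n) * ((2 * n) C n))
      ≡⟨ *-assoc 2 (suc (2 * n)) _ ⟨
    2 * suc (2 * n) * ((2 * n) C n) ∎
    where
    [2+2n]*x≡2*[[1+n]*x] : ∀ n x → (2 + 2 * n) * x ≡ 2 * (suc n * x)
    [2+2n]*x≡2*[[1+n]*x] = solve-∀

  binomialSum-k[N∸k] : ∀ M (w : ℕ → ℕ) →
    binomialSum (2 + M) (λ k → k * (2 + M ∸ k) * w k) ≡ (2 + M) * (1 + M) * binomialSum M (w ∘ suc)
  binomialSum-k[N∸k] M w = begin
    binomialSum (2 + M) t
      ≡⟨ sumTo-suc (suc M) _ ⟩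
    ((2 + M) C 0) * 0 + (sumTo M inner + ((2 + M) C (2 + M)) * t (2 + M))
      ≡⟨ cong₂ _+_ (*-zeroʳ ((2 + M) C 0)) (cong (sumTo M inner +_) last-vanishes) ⟩
    sumTo M inner + 0
      ≡⟨ +-identityʳ _ ⟩
    sumTo M inner
      ≡⟨ sumTo-cong M inner-absorbed ⟩
    sumTo M (λ j → (2 + M) * (1 + M) * ((M C j) * w (suc j)))
      ≡⟨ sumTo-*ˡ M ((2 + M) * (1 + M)) _ ⟩
    (2 + M) * (1 + M) * binomialSum M (w ∘ suc) ∎
    where
    t : ℕ → ℕ
    t k = k * (2 + M ∸ k) * w k
    inner : ℕ → ℕ
    inner j = ((2 + M) C suc j) * t (suc j)
    last-vanishes : ((2 + M) C (2 + M)) * t (2 + M) ≡ 0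
    last-vanishes = begin
      ((2 + M) C (2 + M)) * ((2 + M) * (2 + M ∸ (2 + M)) * w (2 + M))
        ≡⟨ cong (λ m → ((2 + M) C (2 + M)) * ((2 + M) * m * w (2 + M))) (n∸n≡0 (2 + M)) ⟩
      ((2 + M) C (2 + M)) * ((2 + M) * 0 * w (2 + M))
        ≡⟨ cong (λ m → ((2 + M) C (2 + M)) * (m * w (2 + M))) (*-zeroʳ (2 + M)) ⟩
      ((2 + M) C (2 + M)) * 0
        ≡⟨ *-zeroʳ ((2 + M) C (2 + M)) ⟩
      0 ∎
    inner-absorbed : ∀ j → j ≤ M → inner j ≡ (2 + M) * (1 + M) * ((M C j) * w (suc j))
    inner-absorbed j j≤M = begin
      ((2 + M) C suc j) * (suc j * (suc M ∸ j) * w (suc j))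
        ≡⟨ *-assoc ((2 + M) C suc j) (suc j * (suc M ∸ j)) (w (suc j)) ⟨
      ((2 + M) C suc j) * (suc j * (suc M ∸ j)) * w (suc j)
        ≡⟨ cong (_* w (suc j)) (binomial-*-k[N∸k] M j j≤M) ⟩
      (2 + M) * (1 + M) * (M C j) * w (suc j)
        ≡⟨ *-assoc ((2 + M) * (1 + M)) (M C j) (w (suc j)) ⟩
      (2 + M) * (1 + M) * ((M C j) * w (suc j)) ∎

module Moments where

  open import Data.Nat
  open import Data.Nat.Properties
  open import Data.Nat.Combinatorics using (_C_)
  open import Data.Nat.Tactic.RingSolver using (solve-∀)
  open import Data.Product using (_,_)
  open import Data.Sum using (inj₁; inj₂)
  open import Relation.Binary.PropositionalEquality
  open ≡-Reasoning
  open BinomialSums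

  S-suc : ∀ m n → S m (suc n) ≡ binomialSum (2 + 2 * n) (λ k → ∣ suc n - k ∣ ^ m)
  S-suc m n = cong (λ N → binomialSum N (λ k → ∣ suc n - k ∣ ^ m)) (2*[1+n]≡2+2*n n)

  S-zero : ∀ n → S 0 n ≡ 2 ^ (2 * n)
  S-zero n = binomialSum-const (2 * n)

  ∣a-k∣²+k[2a∸k]≡a² : ∀ a k → k ≤ a + a → ∣ a - k ∣ * ∣ a - k ∣ + k * (a + a ∸ k) ≡ a * a
  ∣a-k∣²+k[2a∸k]≡a² a k k≤2a with ≤-total k a
  ... | inj₁ k≤a with m≤n⇒∃[o]m+o≡n k≤a
  ...   | t , refl = begin
    ∣ k + t - k ∣ * ∣ k + t - k ∣ + k * ((k + t) + (k + t) ∸ k)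
      ≡⟨ cong₂ (λ x y → x * x + k * y) (trans (∣-∣-comm (k + t) k) (∣m-m+n∣≡n k t))
               (trans (cong (_∸ k) (+-assoc k t (k + t))) (m+n∸m≡n k (t + (k + t)))) ⟩
    t * t + k * (t + (k + t))
      ≡⟨ below k t ⟩
    (k + t) * (k + t) ∎
    where
    below : ∀ k t → t * t + k * (t + (k + t)) ≡ (k + t) * (k + t)
    below = solve-∀
  ∣a-k∣²+k[2a∸k]≡a² a k k≤2a | inj₂ a≤k with m≤n⇒∃[o]m+o≡n a≤k
  ... | t , refl with m≤n⇒∃[o]m+o≡n (+-cancelˡ-≤ a t a k≤2a)
  ...   | u , refl = begin
    ∣ t + u - (t + u) + t ∣ * ∣ t + u - (t + u) + t ∣ + ((t + u) + t) * ((t + u) + (t + u) ∸ ((t + u) + t))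
      ≡⟨ cong₂ (λ x y → x * x + ((t + u) + t) * y) (∣m-m+n∣≡n (t + u) t)
               (trans ([m+n]∸[m+o]≡n∸o (t + u) (t + u) t) (m+n∸m≡n t u)) ⟩
    t * t + ((t + u) + t) * u
      ≡⟨ above t u ⟩
    (t + u) * (t + u) ∎
    where
    above : ∀ t u → t * t + ((t + u) + t) * u ≡ (t + u) * (t + u)
    above = solve-∀

  ∣1+n-i∣+∣n-1-i∣≡2∣n-i∣+2δ : ∀ n i → ∣ suc n - i ∣ + ∣ n - suc i ∣ ≡ 2 * ∣ n - i ∣ + 2 * δ n i
  ∣1+n-i∣+∣n-1-i∣≡2∣n-i∣+2δ zero    zero    = refl
  ∣1+n-i∣+∣n-1-i∣≡2∣n-i∣+2δ zero    (suc i) = i+[2+i]≡2*[1+i]+0 i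
    where
    i+[2+i]≡2*[1+i]+0 : ∀ i → i + suc (suc i) ≡ 2 * suc i + 0
    i+[2+i]≡2*[1+i]+0 = solve-∀
  ∣1+n-i∣+∣n-1-i∣≡2∣n-i∣+2δ (suc n) zero    =
    trans (cong (2 + n +_) (∣-∣-identityʳ n)) ([2+n]+n≡2*[1+n]+0 n)
    where
    [2+n]+n≡2*[1+n]+0 : ∀ n → suc (suc n) + n ≡ 2 * suc n + 0
    [2+n]+n≡2*[1+n]+0 = solve-∀
  ∣1+n-i∣+∣n-1-i∣≡2∣n-i∣+2δ (suc n) (suc i) = ∣1+n-i∣+∣n-1-i∣≡2∣n-i∣+2δ n i

  S-one : ∀ n → S 1 n ≡ n * ((2 * n) C n)
  S-one zero    = refl
  S-one (suc n) = begin
    S 1 (suc n)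
      ≡⟨ S-suc 1 n ⟩
    binomialSum (2 + 2 * n) g
      ≡⟨ binomialSum-suc (suc (2 * n)) g ⟩
    binomialSum (suc (2 * n)) (λ j → g j + g (suc j))
      ≡⟨ binomialSum-suc (2 * n) _ ⟩
    binomialSum (2 * n) (λ i → (g i + g (suc i)) + (g (suc i) + g (2 + i)))
      ≡⟨ binomialSum-cong (2 * n) second-difference ⟩
    binomialSum (2 * n) (λ i → 4 * ∣ n - i ∣ ^ 1 + 2 * δ n i)
      ≡⟨ binomialSum-+ (2 * n) _ _ ⟩
    binomialSum (2 * n) (λ i → 4 * ∣ n - i ∣ ^ 1) + binomialSum (2 * n) (λ i → 2 * δ n i)
      ≡⟨ cong₂ _+_ (binomialSum-*ˡ (2 * n) 4 _) (binomialSum-*ˡ (2 * n) 2 _) ⟩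
    4 * S 1 n + 2 * binomialSum (2 * n) (δ n)
      ≡⟨ cong₂ (λ a b → 4 * a + 2 * b) (S-one n) (sumTo-*δ (2 * n) ((2 * n) C_) (m≤n*m n 2)) ⟩
    4 * (n * c) + 2 * c
      ≡⟨ 4*[n*c]+2*c≡2*[1+2n]*c n c ⟩
    2 * suc (2 * n) * c
      ≡⟨ central-binomial-suc n ⟨
    suc n * ((2 * suc n) C suc n) ∎
    where
    c = (2 * n) C n
    g : ℕ → ℕ
    g k = ∣ suc n - k ∣ ^ 1
    4*[n*c]+2*c≡2*[1+2n]*c : ∀ n c → 4 * (n * c) + 2 * c ≡ 2 * suc (2 * n) * c
    4*[n*c]+2*c≡2*[1+2n]*c = solve-∀
    second-difference : ∀ i → i ≤ 2 * n →
      (g i + g (suc i)) + (g (suc i) + g (2 + i)) ≡ 4 * ∣ n - i ∣ ^ 1 + 2 * δ n i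
    second-difference i _ = begin
      (a * 1 + b * 1) + (b * 1 + c′ * 1) ≡⟨ regroup a b c′ ⟩
      (a + c′) + 2 * b                  ≡⟨ cong (_+ 2 * b) (∣1+n-i∣+∣n-1-i∣≡2∣n-i∣+2δ n i) ⟩
      (2 * b + 2 * δ n i) + 2 * b       ≡⟨ collect b (δ n i) ⟩
      4 * (b * 1) + 2 * δ n i           ∎
      where
      a = ∣ suc n - i ∣
      b = ∣ n - i ∣
      c′ = ∣ n - suc i ∣
      regroup : ∀ a b c → (a * 1 + b * 1) + (b * 1 + c * 1) ≡ (a + c) + 2 * b
      regroup = solve-∀
      collect : ∀ b d → (2 * b + 2 * d) + 2 * b ≡ 4 * (b * 1) + 2 * d
      collect = solve-∀

  S-recurrence : ∀ m n →
    S (2 + m) (suc n) + (2 + 2 * n) * (1 + 2 * n) * S m n ≡ suc n * suc n * S m (suc n)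
  S-recurrence m n = begin
    S (2 + m) (suc n) + N * (1 + 2 * n) * S m n
      ≡⟨ cong₂ _+_ (sym (S-suc (2 + m) n)) (binomialSum-k[N∸k] (2 * n) w) ⟨
    binomialSum N (λ k → ∣ a - k ∣ ^ (2 + m)) + binomialSum N (λ k → k * (N ∸ k) * w k)
      ≡⟨ binomialSum-+ N _ _ ⟨
    binomialSum N (λ k → ∣ a - k ∣ ^ (2 + m) + k * (N ∸ k) * w k)
      ≡⟨ binomialSum-cong N completes-square ⟩
    binomialSum N (λ k → a * a * w k)
      ≡⟨ binomialSum-*ˡ N (a * a) w ⟩
    a * a * binomialSum N w
      ≡⟨ cong (a * a *_) (S-suc m n) ⟨
    a * a * S m (suc n) ∎
    where
    a = suc n
    N = 2 + 2 * n
    w : ℕ → ℕ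
    w k = ∣ a - k ∣ ^ m
    N≡a+a : N ≡ a + a
    N≡a+a = sym (trans (+-suc (suc n) n) (cong (2 +_) (sym (2*n≡n+n n))))
    completes-square : ∀ k → k ≤ N → ∣ a - k ∣ ^ (2 + m) + k * (N ∸ k) * w k ≡ a * a * w k
    completes-square k k≤N = begin
      u * (u * w k) + k * (N ∸ k) * w k   ≡⟨ factor u (k * (N ∸ k)) (w k) ⟩
      (u * u + k * (N ∸ k)) * w k         ≡⟨ cong (λ M → (u * u + k * (M ∸ k)) * w k) N≡a+a ⟩
      (u * u + k * (a + a ∸ k)) * w k     ≡⟨ cong (_* w k) (∣a-k∣²+k[2a∸k]≡a² a k (subst (k ≤_) N≡a+a k≤N)) ⟩
      a * a * w k                         ∎
      where
      u = ∣ a - k ∣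
      factor : ∀ u v w → u * (u * w) + v * w ≡ (u * u + v) * w
      factor = solve-∀

module Polynomials where

  open import Data.Nat using (ℕ; zero; suc)
  open import Data.Integer using (ℤ; +_; _+_; _*_; _-_)
  open import Data.Integer.Properties using (+-identityˡ; +-identityʳ; *-zeroʳ)
  open import Data.Integer.Tactic.RingSolver using (solve-∀)
  open import Data.Vec using (Vec; []; _∷_; _∷ʳ_; last; zipWith)
  open import Data.Vec.Properties using (last-∷ʳ)
  open import Relation.Binary.PropositionalEquality
  open ≡-Reasoning

  private
    variable
      n : ℕ

  X*_ : Vec ℤ n → Vec ℤ (suc n)
  X* p = + 0 ∷ p

  -- For p = c + x q:  p(x − 1) = (c + x q(x − 1)) − q(x − 1).
  E⁻¹ : Vec ℤ n → Vec ℤ n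
  E⁻¹ []      = []
  E⁻¹ (c ∷ p) = zipWith _-_ (c ∷ E⁻¹ p) (E⁻¹ p ∷ʳ + 0)

  -- For p = c + x q:  p(x) − p(x − 1) = q(x − 1) + x (q(x) − q(x − 1)).
  ∇ : Vec ℤ (suc n) → Vec ℤ n
  ∇ (c ∷ [])        = []
  ∇ (c ∷ q@(_ ∷ _)) = zipWith _+_ (E⁻¹ q) (X* ∇ q)

  eval-X* : ∀ (p : Vec ℤ n) x → eval (X* p) x ≡ x * eval p x
  eval-X* p x = +-identityˡ (x * eval p x)

  eval-[c] : ∀ c x → eval (c ∷ []) x ≡ c
  eval-[c] c x = trans (cong (_+_ c) (*-zeroʳ x)) (+-identityʳ c)

  eval-zipWith-+ : ∀ (p q : Vec ℤ n) x → eval (zipWith _+_ p q) x ≡ eval p x + eval q x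
  eval-zipWith-+ []      []      x = refl
  eval-zipWith-+ (a ∷ p) (b ∷ q) x =
    trans (cong (λ e → (a + b) + x * e) (eval-zipWith-+ p q x)) (interchange a b (eval p x) (eval q x) x)
    where
    interchange : ∀ a b c d x → (a + b) + x * (c + d) ≡ (a + x * c) + (b + x * d)
    interchange = solve-∀

  eval-zipWith-- : ∀ (p q : Vec ℤ n) x → eval (zipWith _-_ p q) x ≡ eval p x - eval q x
  eval-zipWith-- []      []      x = refl
  eval-zipWith-- (a ∷ p) (b ∷ q) x =
    trans (cong (λ e → (a - b) + x * e) (eval-zipWith-- p q x)) (interchange a b (eval p x) (eval q x) x)
    where
    interchange : ∀ a b c d x → (a - b) + x * (c - d) ≡ (a + x * c) - (b + x * d)
    interchange = solve-∀

  eval-∷ʳ0 : ∀ (p : Vec ℤ n) x → eval (p ∷ʳ + 0) x ≡ eval p x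
  eval-∷ʳ0 []      x = trans (+-identityˡ (x * + 0)) (*-zeroʳ x)
  eval-∷ʳ0 (c ∷ p) x = cong (λ e → c + x * e) (eval-∷ʳ0 p x)

  eval-E⁻¹ : ∀ (p : Vec ℤ n) x → eval (E⁻¹ p) x ≡ eval p (x - + 1)
  eval-E⁻¹ []      x = refl
  eval-E⁻¹ (c ∷ p) x = begin
    eval (zipWith _-_ (c ∷ E⁻¹ p) (E⁻¹ p ∷ʳ + 0)) x
      ≡⟨ eval-zipWith-- (c ∷ E⁻¹ p) (E⁻¹ p ∷ʳ + 0) x ⟩
    (c + x * eval (E⁻¹ p) x) - eval (E⁻¹ p ∷ʳ + 0) x
      ≡⟨ cong ((c + x * eval (E⁻¹ p) x) -_) (eval-∷ʳ0 (E⁻¹ p) x) ⟩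
    (c + x * eval (E⁻¹ p) x) - eval (E⁻¹ p) x
      ≡⟨ cong (λ e → (c + x * e) - e) (eval-E⁻¹ p x) ⟩
    (c + x * q) - q
      ≡⟨ factor c x q ⟩
    c + (x - + 1) * q ∎
    where
    q = eval p (x - + 1)
    factor : ∀ c x q → (c + x * q) - q ≡ c + (x - + 1) * q
    factor = solve-∀

  eval-∇ : ∀ (p : Vec ℤ (suc n)) x → eval (∇ p) x ≡ eval p x - eval p (x - + 1)
  eval-∇ (c ∷ [])          x = vanishes c x
    where
    vanishes : ∀ c x → + 0 ≡ (c + x * + 0) - (c + (x - + 1) * + 0)
    vanishes = solve-∀
  eval-∇ (c ∷ q@(_ ∷ _)) x = begin
    eval (zipWith _+_ (E⁻¹ q) (X* ∇ q)) x
      ≡⟨ eval-zipWith-+ (E⁻¹ q) (X* ∇ q) x ⟩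
    eval (E⁻¹ q) x + eval (X* ∇ q) x
      ≡⟨ cong₂ _+_ (eval-E⁻¹ q x) (eval-X* (∇ q) x) ⟩
    eval q (x - + 1) + x * eval (∇ q) x
      ≡⟨ cong (λ e → eval q (x - + 1) + x * e) (eval-∇ q x) ⟩
    eval q (x - + 1) + x * (eval q x - eval q (x - + 1))
      ≡⟨ rearrange c x (eval q x) (eval q (x - + 1)) ⟩
    (c + x * eval q x) - (c + (x - + 1) * eval q (x - + 1)) ∎
    where
    rearrange : ∀ c x a b → b + x * (a - b) ≡ (c + x * a) - (c + (x - + 1) * b)
    rearrange = solve-∀

  last-zipWith : ∀ (f : ℤ → ℤ → ℤ) (p q : Vec ℤ (suc n)) → last (zipWith f p q) ≡ f (last p) (last q)
  last-zipWith f (a ∷ [])        (b ∷ [])        = refl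
  last-zipWith f (a ∷ p@(_ ∷ _)) (b ∷ q@(_ ∷ _)) = last-zipWith f p q

  last-E⁻¹ : ∀ (p : Vec ℤ (suc n)) → last (E⁻¹ p) ≡ last p
  last-E⁻¹ (c ∷ p) = begin
    last (zipWith _-_ (c ∷ E⁻¹ p) (E⁻¹ p ∷ʳ + 0))  ≡⟨ last-zipWith _-_ (c ∷ E⁻¹ p) (E⁻¹ p ∷ʳ + 0) ⟩
    last (c ∷ E⁻¹ p) - last (E⁻¹ p ∷ʳ + 0)        ≡⟨ cong (last (c ∷ E⁻¹ p) -_) (last-∷ʳ (+ 0) (E⁻¹ p)) ⟩
    last (c ∷ E⁻¹ p) + + 0                        ≡⟨ +-identityʳ (last (c ∷ E⁻¹ p)) ⟩
    last (c ∷ E⁻¹ p)                              ≡⟨ last-cons p ⟩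
    last (c ∷ p)                                  ∎
    where
    last-cons : ∀ {n} (p : Vec ℤ n) → last (c ∷ E⁻¹ p) ≡ last (c ∷ p)
    last-cons []          = refl
    last-cons p@(_ ∷ _)   = last-E⁻¹ p

  last-∇ : ∀ (p : Vec ℤ (suc (suc n))) → last (∇ p) ≡ + suc n * last p
  last-∇ {n} (c ∷ q@(_ ∷ _)) = begin
    last (zipWith _+_ (E⁻¹ q) (X* ∇ q))  ≡⟨ last-zipWith _+_ (E⁻¹ q) (X* ∇ q) ⟩
    last (E⁻¹ q) + last (X* ∇ q)        ≡⟨ cong₂ _+_ (last-E⁻¹ q) (last-X*∇ n q) ⟩
    last q + + n * last q               ≡⟨ collect (last q) (+ n) ⟩
    + suc n * last q                    ∎
    where
    collect : ∀ a k → a + k * a ≡ (+ 1 + k) * a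
    collect = solve-∀
    last-X*∇ : ∀ n (q : Vec ℤ (suc n)) → last (X* ∇ q) ≡ + n * last q
    last-X*∇ zero    (d ∷ []) = refl
    last-X*∇ (suc n) q        = last-∇ q

module ClosedForms where

  open import Data.Nat using (ℕ; zero; suc) renaming (_+_ to _+ℕ_; _*_ to _*ℕ_; _^_ to _^ℕ_)
  open import Data.Nat.Combinatorics using (_C_)
  open import Data.Nat.Properties using () renaming (*-identityʳ to *ℕ-identityʳ)
  open import Data.Nat.Tactic.RingSolver using () renaming (solve-∀ to solveℕ-∀)
  open import Data.Integer using (ℤ; +_; _+_; _*_; _-_)
  open import Data.Integer.Properties using (pos-+; pos-*; *-identityˡ; *-identityʳ; *-zeroʳ; i*j≡0⇒i≡0∨j≡0)
  open import Data.Integer.Tactic.RingSolver using (solve-∀)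
  open import Data.Vec using (Vec; []; _∷_; last; zipWith)
  open import Data.Sum using (inj₁; inj₂)
  open import Relation.Binary.PropositionalEquality
  open ≡-Reasoning
  open BinomialSums using (central-binomial-suc; 2*[1+n]≡2+2*n)
  open Moments using (S-zero; S-one; S-recurrence)
  open Polynomials

  private
    variable
      d : ℕ

  P-step : Vec ℤ d → Vec ℤ (suc d)
  P-step p = X* ∇ (X* p)

  Q-step : Vec ℤ d → Vec ℤ (suc d)
  Q-step q = X* zipWith _-_ (zipWith _+_ Δ Δ) (E⁻¹ q)
    where
    Δ = ∇ (X* q)

  P : ∀ r → Vec ℤ (suc r)
  P zero    = + 1 ∷ []
  P (suc r) = P-step (P r)

  Q : ∀ r → Vec ℤ (suc r)
  Q zero    = + 1 ∷ []
  Q (suc r) = Q-step (Q r)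

  eval-∇X* : ∀ (p : Vec ℤ d) x → eval (∇ (X* p)) x ≡ x * eval p x - (x - + 1) * eval p (x - + 1)
  eval-∇X* p x =
    trans (eval-∇ (X* p) x) (cong₂ _-_ (eval-X* p x) (eval-X* p (x - + 1)))

  eval-P-step : ∀ (p : Vec ℤ d) x →
    eval (P-step p) x ≡ x * (x * eval p x - (x - + 1) * eval p (x - + 1))
  eval-P-step p x = trans (eval-X* (∇ (X* p)) x) (cong (x *_) (eval-∇X* p x))

  eval-Q-step : ∀ (q : Vec ℤ d) x →
    eval (Q-step q) x ≡ x * (+ 2 * (x * eval q x - (x - + 1) * eval q (x - + 1)) - eval q (x - + 1))
  eval-Q-step q x = begin
    eval (Q-step q) x
      ≡⟨ eval-X* (zipWith _-_ (zipWith _+_ Δ Δ) (E⁻¹ q)) x ⟩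
    x * eval (zipWith _-_ (zipWith _+_ Δ Δ) (E⁻¹ q)) x
      ≡⟨ cong (x *_) (eval-zipWith-- (zipWith _+_ Δ Δ) (E⁻¹ q) x) ⟩
    x * (eval (zipWith _+_ Δ Δ) x - eval (E⁻¹ q) x)
      ≡⟨ cong₂ (λ a b → x * (a - b)) (eval-zipWith-+ Δ Δ x) (eval-E⁻¹ q x) ⟩
    x * ((eval Δ x + eval Δ x) - eval q (x - + 1))
      ≡⟨ cong (λ a → x * ((a + a) - eval q (x - + 1))) (eval-∇X* q x) ⟩
    x * ((D + D) - eval q (x - + 1))
      ≡⟨ cong (λ a → x * (a - eval q (x - + 1))) (a+a≡2*a D) ⟩
    x * (+ 2 * D - eval q (x - + 1)) ∎
    where
    Δ = ∇ (X* q)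
    D = x * eval q x - (x - + 1) * eval q (x - + 1)
    a+a≡2*a : ∀ a → a + a ≡ + 2 * a
    a+a≡2*a = solve-∀

  last-P-step : ∀ (p : Vec ℤ (suc d)) → last (P-step p) ≡ + suc d * last p
  last-P-step p = last-∇ (X* p)

  last-Q-step : ∀ (q : Vec ℤ (suc d)) → last (Q-step q) ≡ + suc (d +ℕ d) * last q
  last-Q-step {d} q = begin
    last (zipWith _-_ (zipWith _+_ Δ Δ) (E⁻¹ q))
      ≡⟨ last-zipWith _-_ (zipWith _+_ Δ Δ) (E⁻¹ q) ⟩
    last (zipWith _+_ Δ Δ) - last (E⁻¹ q)
      ≡⟨ cong₂ _-_ (last-zipWith _+_ Δ Δ) (last-E⁻¹ q) ⟩
    (last Δ + last Δ) - last q
      ≡⟨ cong (λ a → (a + a) - last q) (last-∇ (X* q)) ⟩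
    (+ suc d * last q + + suc d * last q) - last q
      ≡⟨ collect (+ d) (last q) ⟩
    + suc (d +ℕ d) * last q ∎
    where
    Δ = ∇ (X* q)
    collect : ∀ k a → ((+ 1 + k) * a + (+ 1 + k) * a) - a ≡ (+ 1 + (k + k)) * a
    collect = solve-∀

  +[1+k]*i≢0 : ∀ k {i} → i ≢ + 0 → + suc k * i ≢ + 0
  +[1+k]*i≢0 k i≢0 eq with i*j≡0⇒i≡0∨j≡0 (+ suc k) eq
  ... | inj₁ ()
  ... | inj₂ i≡0 = i≢0 i≡0

  last-P≢0 : ∀ r → last (P r) ≢ + 0
  last-P≢0 zero    ()
  last-P≢0 (suc r) = subst (_≢ + 0) (sym (last-P-step (P r))) (+[1+k]*i≢0 r (last-P≢0 r))

  last-Q≢0 : ∀ r → last (Q r) ≢ + 0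
  last-Q≢0 zero    ()
  last-Q≢0 (suc r) = subst (_≢ + 0) (sym (last-Q-step (Q r))) (+[1+k]*i≢0 (r +ℕ r) (last-Q≢0 r))

  +-≡⇒ℤ-difference : ∀ {a b c} → a +ℕ b ≡ c → + a ≡ + c - + b
  +-≡⇒ℤ-difference {a} {b} refl = trans (a≡[a+b]-b (+ a) (+ b)) (cong (_- + b) (sym (pos-+ a b)))
    where
    a≡[a+b]-b : ∀ a b → a ≡ (a + b) - b
    a≡[a+b]-b = solve-∀

  pos-*³ : ∀ a b c → + (a *ℕ b *ℕ c) ≡ + a * + b * + c
  pos-*³ a b c = trans (pos-* (a *ℕ b) c) (cong (_* + c) (pos-* a b))

  pos-2+2n : ∀ n → + (2 +ℕ 2 *ℕ n) ≡ + 2 + + 2 * + n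
  pos-2+2n n = cong (_+_ (+ 2)) (pos-* 2 n)

  pos-1+2n : ∀ n → + (1 +ℕ 2 *ℕ n) ≡ + 1 + + 2 * + n
  pos-1+2n n = cong (_+_ (+ 1)) (pos-* 2 n)

  S-recurrenceℤ : ∀ m n → + S (2 +ℕ m) (suc n) ≡
    (+ 1 + + n) * (+ 1 + + n) * + S m (suc n) - (+ 2 + + 2 * + n) * (+ 1 + + 2 * + n) * + S m n
  S-recurrenceℤ m n = begin
    + S (2 +ℕ m) (suc n)
      ≡⟨ +-≡⇒ℤ-difference (S-recurrence m n) ⟩
    + (suc n *ℕ suc n *ℕ S m (suc n)) - + ((2 +ℕ 2 *ℕ n) *ℕ (1 +ℕ 2 *ℕ n) *ℕ S m n)
      ≡⟨ cong₂ _-_ (pos-*³ (suc n) (suc n) (S m (suc n))) (pos-*³ (2 +ℕ 2 *ℕ n) (1 +ℕ 2 *ℕ n) (S m n)) ⟩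
    + suc n * + suc n * + S m (suc n) - + (2 +ℕ 2 *ℕ n) * + (1 +ℕ 2 *ℕ n) * + S m n
      ≡⟨ cong₂ (λ a b → + suc n * + suc n * + S m (suc n) - a * b * + S m n) (pos-2+2n n) (pos-1+2n n) ⟩
    (+ 1 + + n) * (+ 1 + + n) * + S m (suc n) - (+ 2 + + 2 * + n) * (+ 1 + + 2 * + n) * + S m n ∎

  central-binomial-sucℤ : ∀ n →
    + (suc n *ℕ ((2 *ℕ suc n) C suc n)) ≡ + 2 * (+ 1 + + 2 * + n) * + ((2 *ℕ n) C n)
  central-binomial-sucℤ n = begin
    + (suc n *ℕ ((2 *ℕ suc n) C suc n))      ≡⟨ cong +_ (central-binomial-suc n) ⟩
    + (2 *ℕ suc (2 *ℕ n) *ℕ ((2 *ℕ n) C n))  ≡⟨ pos-*³ 2 (suc (2 *ℕ n)) ((2 *ℕ n) C n) ⟩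
    + 2 * + suc (2 *ℕ n) * + ((2 *ℕ n) C n)  ≡⟨ cong (λ a → + 2 * a * + ((2 *ℕ n) C n)) (pos-1+2n n) ⟩
    + 2 * (+ 1 + + 2 * + n) * + ((2 *ℕ n) C n) ∎

  pos-4^[1+n] : ∀ n → + (2 ^ℕ (2 *ℕ suc n)) ≡ + 4 * + (2 ^ℕ (2 *ℕ n))
  pos-4^[1+n] n = begin
    + (2 ^ℕ (2 *ℕ suc n))      ≡⟨ cong (λ e → + (2 ^ℕ e)) (2*[1+n]≡2+2*n n) ⟩
    + (2 *ℕ (2 *ℕ w))          ≡⟨ cong +_ (2*[2*w]≡4*w w) ⟩
    + (4 *ℕ w)                 ≡⟨ pos-* 4 w ⟩
    + 4 * + w                  ∎
    where
    w = 2 ^ℕ (2 *ℕ n)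
    2*[2*w]≡4*w : ∀ w → 2 *ℕ (2 *ℕ w) ≡ 4 *ℕ w
    2*[2*w]≡4*w = solveℕ-∀

  S-odd-step : ∀ m (p : Vec ℤ d) →
    (∀ n → + S m n ≡ eval p (+ n) * + (n *ℕ ((2 *ℕ n) C n))) →
    ∀ n → + S (2 +ℕ m) n ≡ eval (P-step p) (+ n) * + (n *ℕ ((2 *ℕ n) C n))
  S-odd-step m p S≡p zero    = sym (*-zeroʳ (eval (P-step p) (+ 0)))
  S-odd-step m p S≡p (suc n) = begin
    + S (2 +ℕ m) (suc n)
      ≡⟨ S-recurrenceℤ m n ⟩
    (+ 1 + x) * (+ 1 + x) * + S m (suc n) - (+ 2 + + 2 * x) * (+ 1 + + 2 * x) * + S m n
      ≡⟨ cong₂ (λ a b → (+ 1 + x) * (+ 1 + x) * a - (+ 2 + + 2 * x) * (+ 1 + + 2 * x) * b)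
               (trans (S≡p (suc n)) (cong (eval p (+ suc n) *_) (central-binomial-sucℤ n)))
               (trans (S≡p n) (cong (eval p x *_) (pos-* n ((2 *ℕ n) C n)))) ⟩
    (+ 1 + x) * (+ 1 + x) * (p₁ * (+ 2 * (+ 1 + + 2 * x) * c))
      - (+ 2 + + 2 * x) * (+ 1 + + 2 * x) * (p₀ * (x * c))
      ≡⟨ factor x p₁ p₀ c ⟩
    (+ 1 + x) * ((+ 1 + x) * p₁ - x * p₀) * (+ 2 * (+ 1 + + 2 * x) * c)
      ≡⟨ cong₂ _*_ (eval-P-step p (+ suc n)) (central-binomial-sucℤ n) ⟨
    eval (P-step p) (+ suc n) * + (suc n *ℕ ((2 *ℕ suc n) C suc n)) ∎
    where
    x = + n
    c = + ((2 *ℕ n) C n)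
    p₁ = eval p (+ suc n)
    p₀ = eval p x
    factor : ∀ x p₁ p₀ c →
      (+ 1 + x) * (+ 1 + x) * (p₁ * (+ 2 * (+ 1 + + 2 * x) * c)) - (+ 2 + + 2 * x) * (+ 1 + + 2 * x) * (p₀ * (x * c))
      ≡ (+ 1 + x) * ((+ 1 + x) * p₁ - x * p₀) * (+ 2 * (+ 1 + + 2 * x) * c)
    factor = solve-∀

  S-even-step : ∀ m k (q : Vec ℤ d) →
    (∀ n → + (S m n *ℕ 2 ^ℕ k) ≡ eval q (+ n) * + (2 ^ℕ (2 *ℕ n))) →
    ∀ n → + (S (2 +ℕ m) n *ℕ 2 ^ℕ suc k) ≡ eval (Q-step q) (+ n) * + (2 ^ℕ (2 *ℕ n))
  S-even-step m k q S≡q zero    =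
    sym (trans (*-identityʳ (eval (Q-step q) (+ 0))) (eval-X* (zipWith _-_ (zipWith _+_ Δ Δ) (E⁻¹ q)) (+ 0)))
    where
    Δ = ∇ (X* q)
  S-even-step m k q S≡q (suc n) = begin
    + (S (2 +ℕ m) (suc n) *ℕ (2 *ℕ 2 ^ℕ k))
      ≡⟨ trans (pos-* (S (2 +ℕ m) (suc n)) _) (cong (+ S (2 +ℕ m) (suc n) *_) (pos-* 2 (2 ^ℕ k))) ⟩
    + S (2 +ℕ m) (suc n) * (+ 2 * t)
      ≡⟨ cong (_* (+ 2 * t)) (S-recurrenceℤ m n) ⟩
    ((+ 1 + x) * (+ 1 + x) * + S m (suc n) - (+ 2 + + 2 * x) * (+ 1 + + 2 * x) * + S m n) * (+ 2 * t)
      ≡⟨ distribute x (+ S m (suc n)) (+ S m n) t ⟩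
    + 2 * ((+ 1 + x) * (+ 1 + x) * (+ S m (suc n) * t) - (+ 2 + + 2 * x) * (+ 1 + + 2 * x) * (+ S m n * t))
      ≡⟨ cong₂ (λ a b → + 2 * ((+ 1 + x) * (+ 1 + x) * a - (+ 2 + + 2 * x) * (+ 1 + + 2 * x) * b))
               (trans (sym (pos-* (S m (suc n)) (2 ^ℕ k))) (trans (S≡q (suc n)) (cong (q₁ *_) (pos-4^[1+n] n))))
               (trans (sym (pos-* (S m n) (2 ^ℕ k))) (S≡q n)) ⟩
    + 2 * ((+ 1 + x) * (+ 1 + x) * (q₁ * (+ 4 * w)) - (+ 2 + + 2 * x) * (+ 1 + + 2 * x) * (q₀ * w))
      ≡⟨ factor x q₁ q₀ w ⟩
    (+ 1 + x) * (+ 2 * ((+ 1 + x) * q₁ - x * q₀) - q₀) * (+ 4 * w)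
      ≡⟨ cong₂ _*_ (eval-Q-step q (+ suc n)) (pos-4^[1+n] n) ⟨
    eval (Q-step q) (+ suc n) * + (2 ^ℕ (2 *ℕ suc n)) ∎
    where
    x = + n
    t = + (2 ^ℕ k)
    w = + (2 ^ℕ (2 *ℕ n))
    q₁ = eval q (+ suc n)
    q₀ = eval q x
    distribute : ∀ x a b t →
      ((+ 1 + x) * (+ 1 + x) * a - (+ 2 + + 2 * x) * (+ 1 + + 2 * x) * b) * (+ 2 * t)
      ≡ + 2 * ((+ 1 + x) * (+ 1 + x) * (a * t) - (+ 2 + + 2 * x) * (+ 1 + + 2 * x) * (b * t))
    distribute = solve-∀
    factor : ∀ x q₁ q₀ w →
      + 2 * ((+ 1 + x) * (+ 1 + x) * (q₁ * (+ 4 * w)) - (+ 2 + + 2 * x) * (+ 1 + + 2 * x) * (q₀ * w))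
      ≡ (+ 1 + x) * (+ 2 * ((+ 1 + x) * q₁ - x * q₀) - q₀) * (+ 4 * w)
    factor = solve-∀

  eval-[1]* : ∀ x y → eval (+ 1 ∷ []) x * y ≡ y
  eval-[1]* x y = trans (cong (_* y) (eval-[c] (+ 1) x)) (*-identityˡ y)

  S-odd : ∀ r n → + S (2 *ℕ r +ℕ 1) n ≡ eval (P r) (+ n) * + (n *ℕ ((2 *ℕ n) C n))
  S-odd zero    n = trans (cong +_ (S-one n))
                          (sym (eval-[1]* (+ n) _))
  S-odd (suc r) n = trans (cong (λ m → + S m n) (2*[1+r]+1≡2+[2*r+1] r))
                          (S-odd-step (2 *ℕ r +ℕ 1) (P r) (S-odd r) n)
    where
    2*[1+r]+1≡2+[2*r+1] : ∀ r → 2 *ℕ suc r +ℕ 1 ≡ 2 +ℕ (2 *ℕ r +ℕ 1)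
    2*[1+r]+1≡2+[2*r+1] = solveℕ-∀

  S-even : ∀ r n → + (S (2 *ℕ r) n *ℕ 2 ^ℕ r) ≡ eval (Q r) (+ n) * + (2 ^ℕ (2 *ℕ n))
  S-even zero    n = trans (cong +_ (trans (*ℕ-identityʳ (S 0 n)) (S-zero n)))
                           (sym (eval-[1]* (+ n) _))
  S-even (suc r) n = trans (cong (λ m → + (S m n *ℕ 2 ^ℕ suc r)) (2*[1+n]≡2+2*n r))
                           (S-even-step (2 *ℕ r) r (Q r) (S-even r) n)

open import Data.Nat using (ℕ; suc; _*_; _+_; _^_; _≥_)
open import Data.Nat.Combinatorics using (_C_)
open import Data.Integer using (ℤ; +_) renaming (_*_ to _*ℤ_)
open import Data.Vec using (Vec; last)
open import Data.Product using (Σ; _×_; _,_)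
open import Relation.Binary.PropositionalEquality using (_≡_; _≢_)
open ClosedForms using (P; Q; last-P≢0; last-Q≢0; S-odd; S-even)

mainTheorem1 : (r : ℕ) →
    Σ (Vec ℤ (suc r)) λ P → Σ (Vec ℤ (suc r)) λ Q →
    (last P ≢ + 0) × (last Q ≢ + 0) ×
    ((n : ℕ) → n ≥ 1 →
    (+ S (2 * r + 1) n ≡ eval P (+ n) *ℤ + (n * ((2 * n) C n))) ×
    (+ (S (2 * r) n * 2 ^ r) ≡ eval Q (+ n) *ℤ + (2 ^ (2 * n))))
-- Both identities hold at n = 0 as well.
mainTheorem1 r = P r , Q r , last-P≢0 r , last-Q≢0 r , λ n _ → S-odd r n , S-even r n
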